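{- Let $\phi:G\to H$ be a graph homomorphism. Suppose $\widetilde F$ is a multiset of edges of $G$ satisfying $\mathscr I_{E(G)}(\widetilde F)=1$ and $\mathscr I_{E(G),u}(\widetilde F)=0$ for all $u\in V(H)$. Then there is an edge $e\in\widetilde F$ such that $\phi(e)$ lies on an odd cycle of $H$ all of whose edges are in $\phi(\widetilde F)$, and moreover $\mathscr I(\widetilde F)=1$ for some $\langle e\rangle_\phi$-intersection invariant $\mathscr I$ (i.e. $\mathscr I=\mathscr I_{\langle e\rangle_\phi}$ or $\mathscr I=\mathscr I_{\langle e\rangle_\phi,u}$ for some $u\in V(H)$).
   Context: For a graph $H$, let $\sim$ be the equivalence relation on $E(H)$ generated by $e\sim e'$ whenever $e,e'$ lie in a common 4-cycle; $\langle e\rangle_H$ is the class of $e$. For $e\in E(G)$, $\langle e\rangle_\phi$ is the edge set of the connected component containing $e$ of the subgraph of $G$ formed by the edges in $\phi^{ -1}(\langle\phi(e)\rangle_H)$. For $A\subseteq E(G)$ and $u\in V(H)$, $A_u$ is the set of edges of $A$ with an endpoint in $\phi^{ -1}(u)$. For a multiset $\widetilde F$ of edges of $G$, $\mathscr I_A(\widetilde F)=|\widetilde F\cap A|\bmod 2$ and $\mathscr I_{A,u}(\widetilde F)=|\widetilde F\cap A_u|\bmod 2$, where $\widetilde F\cap A$ keeps each element of $A$ with its multiplicity in $\widetilde F$ and cardinalities are with multiplicity. $\phi(\widetilde F)$ is the multiset of images of the edges of $\widetilde F$. -}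

module Defs where

open import Data.Nat using (ℕ; zero; suc; _+_; _<_; _<?_; s≤s; _%_)
open import Data.Fin using (Fin; toℕ; fromℕ<) renaming (zero to fzero; suc to fsuc)
open import Data.List using (List; []; _∷_; allFin)
open import Data.Product using (_×_; _,_; proj₁; proj₂; Σ; ∃; ∃-syntax)
open import Data.Sum using (_⊎_)
open import Relation.Nullary using (¬_; yes; no)
open import Relation.Binary.PropositionalEquality using (_≡_; _≢_)
open import Relation.Binary.Construct.Closure.Equivalence using (EqClosure)
open import Relation.Binary.Construct.Closure.ReflexiveTransitive using (Star)
open import Function.Definitions using (Injective)

record Graph : Set where
  field
    nV : ℕ
    nE : ℕ
    ends : Fin nE → Fin nV × Fin nV
    loopless : ∀ e → proj₁ (ends e) ≢ proj₂ (ends e)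

  Joins : Fin nE → Fin nV → Fin nV → Set
  Joins e x y = (ends e ≡ (x , y)) ⊎ (ends e ≡ (y , x))

  Inc : Fin nV → Fin nE → Set
  Inc v e = (v ≡ proj₁ (ends e)) ⊎ (v ≡ proj₂ (ends e))

  field
    simple : ∀ e e' → Joins e' (proj₁ (ends e)) (proj₂ (ends e)) → e ≡ e'

  OnCommon4Cycle : Fin nE → Fin nE → Set
  OnCommon4Cycle e e' =
    Σ (Fin 4 → Fin nV) λ v → Injective _≡_ _≡_ v ×
    Σ (Fin 4 → Fin nE) λ c →
      Joins (c fzero) (v fzero) (v (fsuc fzero)) ×
      Joins (c (fsuc fzero)) (v (fsuc fzero)) (v (fsuc (fsuc fzero))) ×
      Joins (c (fsuc (fsuc fzero))) (v (fsuc (fsuc fzero))) (v (fsuc (fsuc (fsuc fzero)))) ×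
      Joins (c (fsuc (fsuc (fsuc fzero)))) (v (fsuc (fsuc (fsuc fzero)))) (v fzero) ×
      (∃[ i ] c i ≡ e) × (∃[ j ] c j ≡ e')

  _∼_ : Fin nE → Fin nE → Set
  _∼_ = EqClosure OnCommon4Cycle

open Graph public

next : ∀ {k} → Fin (suc k) → Fin (suc k)
next {k} i with suc (toℕ i) <? suc k
... | yes p = fromℕ< p
... | no _  = fzero

-- a cycle of length suc k in H: distinct vertices v_0..v_k, edge c i joins v_i, v_{i+1 mod (k+1)}
record Cycle (H : Graph) (k : ℕ) : Set where
  field
    vert : Fin (suc k) → Fin (nV H)
    vert-inj : Injective _≡_ _≡_ vert
    edge : Fin (suc k) → Fin (nE H)
    edge-joins : ∀ i → Joins H (edge i) (vert i) (vert (next i))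
open Cycle public

record Hom (G H : Graph) : Set where
  field
    vmap : Fin (nV G) → Fin (nV H)
    emap : Fin (nE G) → Fin (nE H)
    emap-joins : ∀ e → Joins H (emap e) (vmap (proj₁ (ends G e))) (vmap (proj₂ (ends G e)))
open Hom public

Multiset : Graph → Set
Multiset G = Fin (nE G) → ℕ

data SumOver {n : ℕ} (P : Fin n → Set) (F : Fin n → ℕ) : List (Fin n) → ℕ → Set where
  []  : SumOver P F [] 0
  in∷  : ∀ {e xs s} → P e → SumOver P F xs s → SumOver P F (e ∷ xs) (F e + s)
  out∷ : ∀ {e xs s} → ¬ P e → SumOver P F xs s → SumOver P F (e ∷ xs) s

CardInter : (G : Graph) → (Fin (nE G) → Set) → Multiset G → ℕ → Set
CardInter G A F s = SumOver A F (allFin (nE G)) s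

IntInv : (G : Graph) → (Fin (nE G) → Set) → Multiset G → ℕ → Set
IntInv G A F b = ∃[ s ] CardInter G A F s × (s % 2 ≡ b)

AtVertex : {G H : Graph} → Hom G H → (Fin (nE G) → Set) → Fin (nV H) → Fin (nE G) → Set
AtVertex {G} φ A u e = A e × ((vmap φ (proj₁ (ends G e)) ≡ u) ⊎ (vmap φ (proj₂ (ends G e)) ≡ u))

IntInvAt : {G H : Graph} → Hom G H → (Fin (nE G) → Set) → Fin (nV H) → Multiset G → ℕ → Set
IntInvAt {G} φ A u F b = IntInv G (AtVertex φ A u) F b

AllEdges : (G : Graph) → Fin (nE G) → Set
AllEdges G _ = Data.Unit.⊤
  where import Data.Unit

-- e' ∈ ⟨e⟩_φ : e' is in the component containing e of the subgraph of G with
-- edge set φ⁻¹(⟨φ(e)⟩_H); edges connected via chains of edges of that set sharing a vertex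
InPre : {G H : Graph} → Hom G H → Fin (nE G) → Fin (nE G) → Set
InPre {G} {H} φ e a = _∼_ H (emap φ e) (emap φ a)

ShareVertex : (G : Graph) → Fin (nE G) → Fin (nE G) → Set
ShareVertex G a b = ∃[ v ] Inc G v a × Inc G v b

ClassPhi : {G H : Graph} → Hom G H → Fin (nE G) → Fin (nE G) → Set
ClassPhi {G} φ e e' = Star (λ a b → InPre φ e a × InPre φ e b × ShareVertex G a b) e e'

InImage : {G H : Graph} → Hom G H → Multiset G → Fin (nE H) → Set
InImage φ F h = ∃[ e ] (F e ≢ 0) × (emap φ e ≡ h)

OnOddCycleIn : {G H : Graph} → Hom G H → Multiset G → Fin (nE G) → Set
OnOddCycleIn {G} {H} φ F e =
  Σ ℕ λ k → (suc k % 2 ≡ 1) × Σ (Cycle H k) λ C →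
    (∃[ i ] edge C i ≡ emap φ e) × (∀ i → InImage φ F (edge C i))

-- Call an edge a of G good
-- if one of the ⟨a⟩_φ-intersection invariants of F̃ is odd.  The classes
-- ⟨a⟩_φ partition E(G) and every invariant of a class that is not good is
-- even, so discarding the edges of those classes changes neither
-- 𝓘_{E(G)}(F̃) = 1 nor any 𝓘_{E(G),u}(F̃) = 0.  If the φ-images of the
-- remaining edges of odd multiplicity spanned a bipartite subgraph of H,
-- with colour classes X and V(H) ∖ X, each of these edges would have exactly
-- one end in φ⁻¹(X), so 𝓘_{E(G)} would be the sum of the 𝓘_{E(G),u} over
-- u ∈ X, which is even.  Hence that subgraph has an odd closed walk, hence an
-- odd cycle, and a good edge mapped onto one of its edges is the required e.
{-# OPTIONS --safe #-}
module Submission where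

open import Defs
open import Data.Bool using (if_then_else_)
open import Data.Empty using (⊥-elim)
open import Data.Fin using (Fin; zero; suc; toℕ; inject₁; fromℕ; join; splitAt)
open import Data.Fin.Patterns using (0F; 1F; 2F; 3F)
open import Data.Fin.Properties
  using (_≟_; any?; all?; toℕ-injective; toℕ-inject₁; toℕ-fromℕ; toℕ-fromℕ<; toℕ<n; splitAt-join)
open import Data.Fin.Subset using (Subset; _∈_; _∪_; ⁅_⁆; ∣_∣)
open import Data.Fin.Subset.Properties
  using (_∈?_; x∈⁅x⁆; x∈⁅y⁆⇒x≡y; ∣⁅x⁆∣≡1; x∈p∪q⁻; p⊆p∪q; q⊆p∪q;
         p⊂q⇒∣p∣<∣q∣; ∣p∣≤n)
open import Data.List using ([]; _∷_; tabulate; allFin)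
open import Data.Maybe as Maybe using (Maybe; just; nothing)
open import Data.Maybe.Properties using (just-injective)
open import Data.Nat as ℕ using (ℕ; zero; suc; _+_; _≤_; _<_; _%_; _/_; _<?_; parity)
open import Data.Nat.DivMod using (m≡m%n+[m/n]*n; m%n<n)
import Data.Nat.Properties as ℕₚ
open import Data.Parity.Base as ℙ using (Parity; 0ℙ; 1ℙ)
import Data.Parity.Properties as ℙₚ
open import Algebra.Properties.CommutativeSemigroup ℙₚ.*-commutativeSemigroup
  using (x∙yz≈y∙xz)
open import Algebra.Properties.Semiring.Sum ℙₚ.+-*-semiring
  using (sum-syntax; sum-cong-≗; sum-replicate-zero; ∑-distrib-+; ∑-comm; *-distribˡ-sum)
open import Data.Product using (Σ; _×_; _,_; proj₁; proj₂; ∃; ∃-syntax)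
open import Data.Product.Properties using (≡-dec)
open import Data.Sum using (_⊎_; inj₁; inj₂; [_,_]′)
open import Data.Unit using (tt)
import Data.Vec as Vec
open import Data.Vec.Functional using (head; tail) renaming (_∷_ to _∷ᶠ_)
open import Data.Vec.Properties using (lookup∘tabulate; []=⇒lookup; lookup⇒[]=)
open import Function using (_∘_; id; _⇔_; mk⇔)
open import Function.Definitions using (Injective)
open import Level using (Level; _⊔_)
open import Relation.Binary
  using (Rel; Symmetric; IsEquivalence; DecidableEquality) renaming (Decidable to Decidable₂)
open import Relation.Binary.Construct.Closure.ReflexiveTransitive
  using (Star; ε; _◅_; _◅◅_; return; gmap)
import Relation.Binary.Construct.Closure.ReflexiveTransitive as Star
open import Relation.Binary.Construct.Closure.Symmetric using (SymClosure; fwd; bwd)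
import Relation.Binary.Construct.Closure.Equivalence as EqClosure
open import Relation.Binary.PropositionalEquality
  using (_≡_; _≢_; _≗_; refl; sym; trans; cong; cong₂; subst; subst₂; module ≡-Reasoning)
open import Relation.Nullary using (Dec; yes; no; does; ¬_; ¬?; contradiction)
open import Relation.Nullary.Decidable using (_×-dec_; _⊎-dec_; _→-dec_; map′; dec-true; does-⇔)
open import Relation.Unary using (Decidable)

χ : ∀ {p} {P : Set p} → Dec P → Parity
χ P? = if does P? then 1ℙ else 0ℙ

module _ {p q} {P : Set p} {Q : Set q} where

  χ-cong : P ⇔ Q → (P? : Dec P) (Q? : Dec Q) → χ P? ≡ χ Q?
  χ-cong P⇔Q P? Q? = cong (λ b → if b then 1ℙ else 0ℙ) (does-⇔ P⇔Q P? Q?)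

  χ-× : (P? : Dec P) (Q? : Dec Q) → χ (P? ×-dec Q?) ≡ χ P? ℙ.* χ Q?
  χ-× (yes _) (yes _) = refl
  χ-× (yes _) (no _)  = refl
  χ-× (no _)  _       = refl

  χ-⊎ : ¬ (P × Q) → (P? : Dec P) (Q? : Dec Q) → χ (P? ⊎-dec Q?) ≡ χ P? ℙ.+ χ Q?
  χ-⊎ ¬p×q (yes p) (yes q) = contradiction (p , q) ¬p×q
  χ-⊎ _    (yes _) (no _)  = refl
  χ-⊎ _    (no _)  (yes _) = refl
  χ-⊎ _    (no _)  (no _)  = refl

≢⇒+≡1ℙ : ∀ {p q} → p ≢ q → p ℙ.+ q ≡ 1ℙ
≢⇒+≡1ℙ {0ℙ} {0ℙ} p≢q = contradiction refl p≢q
≢⇒+≡1ℙ {0ℙ} {1ℙ} _   = refl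
≢⇒+≡1ℙ {1ℙ} {0ℙ} _   = refl
≢⇒+≡1ℙ {1ℙ} {1ℙ} p≢q = contradiction refl p≢q

≢1ℙ⇒≡0ℙ : ∀ {p} → p ≢ 1ℙ → p ≡ 0ℙ
≢1ℙ⇒≡0ℙ {0ℙ} _   = refl
≢1ℙ⇒≡0ℙ {1ℙ} p≢1 = contradiction refl p≢1

∑-χ≟ : ∀ {n} (x : Fin n) (g : Fin n → Parity) → ∑[ u < n ] (χ (x ≟ u) ℙ.* g u) ≡ g x
∑-χ≟ {suc n} zero    g = trans (cong (g zero ℙ.+_) (sum-replicate-zero n)) (ℙₚ.+-identityʳ (g zero))
∑-χ≟ {suc n} (suc x) g = ∑-χ≟ x (g ∘ suc)

sumOn : ∀ {n} {P : Fin n → Set} → Decidable P → (Fin n → Parity) → Parity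
sumOn {n} P? w = ∑[ e < n ] (χ (P? e) ℙ.* w e)

parity-%2 : ∀ n → parity (n % 2) ≡ parity n
parity-%2 n = sym (begin
  parity n                                 ≡⟨ cong parity (m≡m%n+[m/n]*n n 2) ⟩
  parity (n % 2 + n / 2 ℕ.* 2)             ≡⟨ ℙₚ.+-homo-+ (n % 2) (n / 2 ℕ.* 2) ⟩
  parity (n % 2) ℙ.+ parity (n / 2 ℕ.* 2)  ≡⟨ cong (parity (n % 2) ℙ.+_) even ⟩
  parity (n % 2) ℙ.+ 0ℙ                    ≡⟨ ℙₚ.+-identityʳ (parity (n % 2)) ⟩
  parity (n % 2)                           ∎)
  where
  open ≡-Reasoning
  even : parity (n / 2 ℕ.* 2) ≡ 0ℙ
  even = trans (ℙₚ.*-homo-* (n / 2) 2) (ℙₚ.*-zeroʳ (parity (n / 2)))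

odd⇒%2≡1 : ∀ n → parity n ≡ 1ℙ → n % 2 ≡ 1
odd⇒%2≡1 n odd with n % 2 | m%n<n n 2 | parity-%2 n
... | 1           | _                | _    = refl
... | 0           | _                | even = contradiction (trans even odd) λ ()
... | suc (suc _) | ℕ.s≤s (ℕ.s≤s ()) | _

module _ {N} {P : Fin N → Set} (P? : Decidable P) (F : Fin N → ℕ) where

  sumOver-parity : ∀ {n} (g : Fin n → Fin N) {s} → SumOver P F (tabulate g) s →
    parity s ≡ ∑[ i < n ] (χ (P? (g i)) ℙ.* parity (F (g i)))
  sumOver-parity {zero}  g [] = refl
  sumOver-parity {suc n} g (in∷ p S) with P? (g zero)
  ... | yes _ = trans (ℙₚ.+-homo-+ (F (g zero)) _) (cong (parity (F (g zero)) ℙ.+_) (sumOver-parity (g ∘ suc) S))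
  ... | no ¬p = contradiction p ¬p
  sumOver-parity {suc n} g (out∷ ¬p S) with P? (g zero)
  ... | yes p = contradiction p ¬p
  ... | no _  = sumOver-parity (g ∘ suc) S

  sumOver-total : ∀ xs → ∃ (SumOver P F xs)
  sumOver-total []       = 0 , []
  sumOver-total (x ∷ xs) with sumOver-total xs | P? x
  ... | s , S | yes p = F x + s , in∷ p S
  ... | s , S | no ¬p = s , out∷ ¬p S

module _ (G : Graph) {A : Fin (nE G) → Set} (A? : Decidable A) (F : Multiset G) where

  IntInv⇒sumOn : ∀ {b} → IntInv G A F b → sumOn A? (parity ∘ F) ≡ parity b
  IntInv⇒sumOn {b} (s , S , s%2≡b) = begin
    sumOn A? (parity ∘ F)  ≡⟨ sumOver-parity A? F id S ⟨
    parity s               ≡⟨ parity-%2 s ⟨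
    parity (s % 2)         ≡⟨ cong parity s%2≡b ⟩
    parity b               ∎
    where open ≡-Reasoning

  sumOn⇒IntInv : sumOn A? (parity ∘ F) ≡ 1ℙ → IntInv G A F 1
  sumOn⇒IntInv odd with sumOver-total A? F (allFin (nE G))
  ... | s , S = s , S , odd⇒%2≡1 s (trans (sumOver-parity A? F id S) odd)

module _ {ℓ : Level} where

  least : ∀ {n} {P : Fin n → Set ℓ} → Decidable P → Maybe (Fin n)
  least {zero}  P? = nothing
  least {suc n} P? = if does (P? zero) then just zero else Maybe.map suc (least (P? ∘ suc))

  least-sound : ∀ {n} {P : Fin n → Set ℓ} (P? : Decidable P) {i} → least P? ≡ just i → P i
  least-sound {suc n} P? eq with P? zero | least (P? ∘ suc) in eq′
  least-sound {suc n} P? refl | yes p | _      = p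
  least-sound {suc n} P? refl | no _  | just j = least-sound (P? ∘ suc) eq′

  least-complete : ∀ {n} {P : Fin n → Set ℓ} (P? : Decidable P) {i} → P i → ∃ λ j → least P? ≡ just j
  least-complete {suc n} P? {i} p with P? zero | least (P? ∘ suc) in eq′
  ... | yes _ | _      = zero , refl
  ... | no _  | just j = suc j , refl
  least-complete {suc n} P? {zero}  p | no ¬p | nothing = contradiction p ¬p
  least-complete {suc n} P? {suc i} p | no _  | nothing with least-complete (P? ∘ suc) p
  ... | _ , eq = contradiction (trans (sym eq′) eq) λ ()

  least-cong : ∀ {n} {P Q : Fin n → Set ℓ} (P? : Decidable P) (Q? : Decidable Q) →
    (∀ i → P i ⇔ Q i) → least P? ≡ least Q?
  least-cong {zero}  P? Q? P⇔Q = refl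
  least-cong {suc n} P? Q? P⇔Q
    rewrite does-⇔ (P⇔Q zero) (P? zero) (Q? zero)
          | least-cong (P? ∘ suc) (Q? ∘ suc) (P⇔Q ∘ suc) = refl

∃-function? : ∀ {p} k {n} {P : (Fin k → Fin n) → Set p} →
  (∀ {f g} → f ≗ g → P f → P g) → (∀ f → Dec (P f)) → Dec (∃ P)
∃-function? zero    resp P? = map′ (_ ,_) (λ (f , p) → resp (λ ()) p) (P? λ ())
∃-function? (suc k) resp P? =
  map′ (λ (a , f , p) → a ∷ᶠ f , p)
       (λ (f , p) → head f , tail f , resp (λ { zero → refl ; (suc i) → refl }) p)
       (any? λ a → ∃-function? k (λ f≗g → resp (λ { zero → refl ; (suc i) → f≗g i }))
                                 (λ f → P? (a ∷ᶠ f)))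

injective? : ∀ {m n} (f : Fin m → Fin n) → Dec (Injective _≡_ _≡_ f)
injective? f = map′ (λ inj {x} {y} → inj x y) (λ inj x y → inj)
  (all? λ x → all? λ y → f x ≟ f y →-dec x ≟ y)

-- Canonical representatives of a decidable equivalence on Fin n

module Classes {n ℓ} {_≈_ : Rel (Fin n) ℓ}
  (≈-isEquivalence : IsEquivalence _≈_) (_≈?_ : Decidable₂ _≈_) where

  open IsEquivalence ≈-isEquivalence
    renaming (refl to ≈-refl; sym to ≈-sym; trans to ≈-trans)

  private
    least≈ : ∀ x → ∃ λ r → least (_≈? x) ≡ just r
    least≈ x = least-complete (_≈? x) (≈-refl {x})

  rep : Fin n → Fin n
  rep x = proj₁ (least≈ x)

  rep-≈ : ∀ x → rep x ≈ x
  rep-≈ x = least-sound (_≈? x) (proj₂ (least≈ x))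

  rep-cong : ∀ {x y} → x ≈ y → rep x ≡ rep y
  rep-cong {x} {y} x≈y = just-injective (begin
    just (rep x)   ≡⟨ proj₂ (least≈ x) ⟨
    least (_≈? x)  ≡⟨ least-cong (_≈? x) (_≈? y) same-class ⟩
    least (_≈? y)  ≡⟨ proj₂ (least≈ y) ⟩
    just (rep y)   ∎)
    where
    open ≡-Reasoning
    same-class : ∀ i → i ≈ x ⇔ i ≈ y
    same-class _ = mk⇔ (λ i≈x → ≈-trans i≈x x≈y) (λ i≈y → ≈-trans i≈y (≈-sym x≈y))

  rep≡⇔ : ∀ {r x} → rep x ≡ r ⇔ (rep r ≡ r × r ≈ x)
  rep≡⇔ {r} {x} = mk⇔
    (λ { refl → rep-cong (rep-≈ x) , rep-≈ x })
    (λ (rep-r≡r , r≈x) → trans (sym (rep-cong r≈x)) rep-r≡r)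

  ∑-by-classes : (f : Fin n → Parity) →
    ∑[ x < n ] f x ≡ ∑[ r < n ] (χ (rep r ≟ r) ℙ.* ∑[ x < n ] (χ (r ≈? x) ℙ.* f x))
  ∑-by-classes f = begin
    ∑[ x < n ] f x
      ≡⟨ sum-cong-≗ (λ x → sym (∑-χ≟ (rep x) (λ _ → f x))) ⟩
    ∑[ x < n ] ∑[ r < n ] (χ (rep x ≟ r) ℙ.* f x)
      ≡⟨ ∑-comm (λ x r → χ (rep x ≟ r) ℙ.* f x) ⟩
    ∑[ r < n ] ∑[ x < n ] (χ (rep x ≟ r) ℙ.* f x)
      ≡⟨ sum-cong-≗ (λ r → sum-cong-≗ (term r)) ⟩
    ∑[ r < n ] ∑[ x < n ] (χ (rep r ≟ r) ℙ.* (χ (r ≈? x) ℙ.* f x))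
      ≡⟨ sum-cong-≗ (λ r → *-distribˡ-sum (χ (rep r ≟ r)) (λ x → χ (r ≈? x) ℙ.* f x)) ⟨
    ∑[ r < n ] (χ (rep r ≟ r) ℙ.* ∑[ x < n ] (χ (r ≈? x) ℙ.* f x))
      ∎
    where
    open ≡-Reasoning
    term : ∀ r x → χ (rep x ≟ r) ℙ.* f x ≡ χ (rep r ≟ r) ℙ.* (χ (r ≈? x) ℙ.* f x)
    term r x = begin
      χ (rep x ≟ r) ℙ.* f x
        ≡⟨ cong (ℙ._* f x) (χ-cong rep≡⇔ (rep x ≟ r) (rep r ≟ r ×-dec r ≈? x)) ⟩
      χ (rep r ≟ r ×-dec r ≈? x) ℙ.* f x
        ≡⟨ cong (ℙ._* f x) (χ-× (rep r ≟ r) (r ≈? x)) ⟩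
      χ (rep r ≟ r) ℙ.* χ (r ≈? x) ℙ.* f x
        ≡⟨ ℙₚ.*-assoc (χ (rep r ≟ r)) (χ (r ≈? x)) (f x) ⟩
      χ (rep r ≟ r) ℙ.* (χ (r ≈? x) ℙ.* f x)
        ∎

  ∑-restrict-to-classes : ∀ {b} {B : Fin n → Set b} (B? : Decidable B) → (∀ {x y} → x ≈ y → B x → B y) →
    (f : Fin n → Parity) → (∀ r → ¬ B r → ∑[ x < n ] (χ (r ≈? x) ℙ.* f x) ≡ 0ℙ) →
    ∑[ x < n ] (χ (B? x) ℙ.* f x) ≡ ∑[ x < n ] f x
  ∑-restrict-to-classes {B = B} B? B-resp f null = begin
    ∑[ x < n ] (χ (B? x) ℙ.* f x)
      ≡⟨ sum-cong-≗ split ⟩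
    ∑[ x < n ] (f x ℙ.+ (χ (¬? (B? x)) ℙ.* f x))
      ≡⟨ ∑-distrib-+ f (λ x → χ (¬? (B? x)) ℙ.* f x) ⟩
    ∑[ x < n ] f x ℙ.+ ∑[ x < n ] (χ (¬? (B? x)) ℙ.* f x)
      ≡⟨ cong (∑[ x < n ] f x ℙ.+_) outside-B ⟩
    ∑[ x < n ] f x ℙ.+ 0ℙ
      ≡⟨ ℙₚ.+-identityʳ _ ⟩
    ∑[ x < n ] f x
      ∎
    where
    open ≡-Reasoning
    split : ∀ x → χ (B? x) ℙ.* f x ≡ f x ℙ.+ (χ (¬? (B? x)) ℙ.* f x)
    split x with B? x
    ... | yes _ = sym (ℙₚ.+-identityʳ (f x))
    ... | no _  = sym (ℙₚ.p+p≡0ℙ (f x))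
    ¬B-resp : ∀ {x y} → x ≈ y → (¬ B x) ⇔ (¬ B y)
    ¬B-resp x≈y = mk⇔ (λ ¬Bx By → ¬Bx (B-resp (≈-sym x≈y) By)) (λ ¬By Bx → ¬By (B-resp x≈y Bx))
    classTerm : ∀ r x → χ (r ≈? x) ℙ.* (χ (¬? (B? x)) ℙ.* f x) ≡
                        χ (¬? (B? r)) ℙ.* (χ (r ≈? x) ℙ.* f x)
    classTerm r x with r ≈? x
    ... | yes r≈x = cong (ℙ._* f x) (χ-cong (¬B-resp (≈-sym r≈x)) (¬? (B? x)) (¬? (B? r)))
    ... | no _    = sym (ℙₚ.*-zeroʳ _)
    vanish : ∀ {r} (Br? : Dec (B r)) {S} → (¬ B r → S ≡ 0ℙ) → χ (¬? Br?) ℙ.* S ≡ 0ℙ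
    vanish (yes _)  _   = refl
    vanish (no ¬Br) S≡0 = S≡0 ¬Br
    classSum : ∀ r → ∑[ x < n ] (χ (r ≈? x) ℙ.* (χ (¬? (B? x)) ℙ.* f x)) ≡ 0ℙ
    classSum r = trans (sum-cong-≗ (classTerm r))
      (trans (sym (*-distribˡ-sum (χ (¬? (B? r))) (λ x → χ (r ≈? x) ℙ.* f x))) (vanish (B? r) (null r)))
    outside-B : ∑[ x < n ] (χ (¬? (B? x)) ℙ.* f x) ≡ 0ℙ
    outside-B = trans (∑-by-classes (λ x → χ (¬? (B? x)) ℙ.* f x))
      (trans (sum-cong-≗ (λ r → trans (cong (χ (rep r ≟ r) ℙ.*_) (classSum r)) (ℙₚ.*-zeroʳ _)))
             (sum-replicate-zero n))

module Reachability {n ℓ} {R : Rel (Fin n) ℓ} (R? : Decidable₂ R) where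

  hasPredecessorIn? : ∀ S y → Dec (∃ λ x → x ∈ S × R x y)
  hasPredecessorIn? S y = any? λ x → x ∈? S ×-dec R? x y

  successors : Subset n → Subset n
  successors S = Vec.tabulate (does ∘ hasPredecessorIn? S)

  successors⁻ : ∀ {S y} → y ∈ successors S → ∃ λ x → x ∈ S × R x y
  successors⁻ {S} {y} y∈ with hasPredecessorIn? S y | trans (sym (lookup∘tabulate _ y)) ([]=⇒lookup y∈)
  ... | yes found | _  = found
  ... | no _      | ()

  successors⁺ : ∀ {S x y} → x ∈ S → R x y → y ∈ successors S
  successors⁺ {S} {x} {y} x∈S r =
    lookup⇒[]= y _ (trans (lookup∘tabulate _ y) (dec-true (hasPredecessorIn? S y) (x , x∈S , r)))

  Closed : Subset n → Set ℓ
  Closed S = ∀ {x y} → x ∈ S → R x y → y ∈ S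

  closed-star : ∀ {S x y} → Closed S → x ∈ S → Star R x y → y ∈ S
  closed-star closed x∈S ε        = x∈S
  closed-star closed x∈S (r ◅ rs) = closed-star closed (closed x∈S r) rs

  closed-step : ∀ {S} → Closed S → Closed (S ∪ successors S)
  closed-step {S} closed x∈ r = p⊆p∪q (successors S) (closed (absorbed x∈) r)
    where
    absorbed : ∀ {x} → x ∈ S ∪ successors S → x ∈ S
    absorbed x∈ with x∈p∪q⁻ S (successors S) x∈
    ... | inj₁ x∈S    = x∈S
    ... | inj₂ x∈succ with successors⁻ x∈succ
    ...   | _ , z∈S , r = closed z∈S r

  fresh? : ∀ S → Dec (∃ λ y → y ∈ successors S × ¬ y ∈ S)
  fresh? S = any? λ y → y ∈? successors S ×-dec ¬? (y ∈? S)

  reached : Fin n → ℕ → Subset n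
  reached a zero    = ⁅ a ⁆
  reached a (suc k) = reached a k ∪ successors (reached a k)

  reached-start : ∀ a k → a ∈ reached a k
  reached-start a zero    = x∈⁅x⁆ a
  reached-start a (suc k) = p⊆p∪q _ (reached-start a k)

  reached-sound : ∀ {a x} k → x ∈ reached a k → Star R a x
  reached-sound {a} zero x∈ = subst (Star R a) (sym (x∈⁅y⁆⇒x≡y a x∈)) ε
  reached-sound {a} (suc k) x∈ with x∈p∪q⁻ (reached a k) _ x∈
  ... | inj₁ x∈S    = reached-sound k x∈S
  ... | inj₂ x∈succ with successors⁻ x∈succ
  ...   | _ , z∈S , r = reached-sound k z∈S ◅◅ return r

  closed-or-growing : ∀ a k → Closed (reached a k) ⊎ k < ∣ reached a k ∣
  closed-or-growing a zero = inj₂ (subst (0 <_) (sym (∣⁅x⁆∣≡1 a)) (ℕ.s≤s ℕ.z≤n))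
  closed-or-growing a (suc k) with closed-or-growing a k | fresh? (reached a k)
  ... | inj₁ closed | _ = inj₁ (closed-step closed)
  ... | inj₂ _ | no ¬new = inj₁ (closed-step closed)
    where
    closed : Closed (reached a k)
    closed {y = y} x∈S r with y ∈? reached a k
    ... | yes y∈S = y∈S
    ... | no y∉S  = contradiction (y , successors⁺ x∈S r , y∉S) ¬new
  ... | inj₂ k<∣S∣ | yes (y , y∈succ , y∉S) =
    inj₂ (ℕₚ.≤-<-trans k<∣S∣ (p⊂q⇒∣p∣<∣q∣ (p⊆p∪q _ , y , q⊆p∪q _ _ y∈succ , y∉S)))

  reached-closed : ∀ a → Closed (reached a n)
  reached-closed a with closed-or-growing a n
  ... | inj₁ closed = closed
  ... | inj₂ n<∣S∣  = contradiction n<∣S∣ (ℕₚ.≤⇒≯ (∣p∣≤n (reached a n)))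

  star? : Decidable₂ (Star R)
  star? a b = map′ (reached-sound n) (closed-star (reached-closed a) (reached-start a n)) (b ∈? reached a n)

star-retract? : ∀ {a ℓ n} {A : Set a} {R : Rel A ℓ} (to : A → Fin n) (from : Fin n → A) →
  (∀ x → from (to x) ≡ x) → Decidable₂ R → Decidable₂ (Star R)
star-retract? {R = R} to from from∘to R? x y =
  map′ (λ s → subst₂ (Star R) (from∘to x) (from∘to y) (gmap from id s))
       (gmap to (λ {u} {v} r → subst₂ R (sym (from∘to u)) (sym (from∘to v)) r))
       (Reachability.star? (λ i j → R? (from i) (from j)) (to x) (to y))

symClosure? : ∀ {a ℓ} {A : Set a} {R : Rel A ℓ} → Decidable₂ R → Decidable₂ (SymClosure R)
symClosure? R? x y with R? x y | R? y x
... | yes r | _      = yes (fwd r)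
... | no _  | yes r  = yes (bwd r)
... | no ¬r | no ¬r′ = no λ { (fwd r) → ¬r r ; (bwd r) → ¬r′ r }

-- Weighted degrees in a properly 2-coloured multigraph

module Incidence {N M} (source target : Fin N → Fin M) where

  incident? : ∀ u e → Dec (source e ≡ u ⊎ target e ≡ u)
  incident? u e = source e ≟ u ⊎-dec target e ≟ u

  degree : (Fin N → Parity) → Fin M → Parity
  degree w u = ∑[ e < N ] (χ (incident? u e) ℙ.* w e)

  ∑-colour*degree : (w : Fin N → Parity) (c : Fin M → Parity) →
    (∀ e → w e ≡ 1ℙ → c (source e) ≢ c (target e)) →
    ∑[ u < M ] (c u ℙ.* degree w u) ≡ ∑[ e < N ] w e
  ∑-colour*degree w c proper = begin
    ∑[ u < M ] (c u ℙ.* degree w u)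
      ≡⟨ sum-cong-≗ (λ u → *-distribˡ-sum (c u) (λ e → χ (incident? u e) ℙ.* w e)) ⟩
    ∑[ u < M ] ∑[ e < N ] (c u ℙ.* (χ (incident? u e) ℙ.* w e))
      ≡⟨ ∑-comm (λ u e → c u ℙ.* (χ (incident? u e) ℙ.* w e)) ⟩
    ∑[ e < N ] ∑[ u < M ] (c u ℙ.* (χ (incident? u e) ℙ.* w e))
      ≡⟨ sum-cong-≗ (λ e → edgeTerm e (w e) refl) ⟩
    ∑[ e < N ] w e
      ∎
    where
    open ≡-Reasoning
    edgeTerm : ∀ e p → w e ≡ p → ∑[ u < M ] (c u ℙ.* (χ (incident? u e) ℙ.* p)) ≡ p
    edgeTerm e 0ℙ _ = trans
      (sum-cong-≗ λ u → trans (cong (c u ℙ.*_) (ℙₚ.*-zeroʳ (χ (incident? u e)))) (ℙₚ.*-zeroʳ (c u)))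
      (sum-replicate-zero M)
    edgeTerm e 1ℙ odd = begin
      ∑[ u < M ] (c u ℙ.* (χ (incident? u e) ℙ.* 1ℙ))
        ≡⟨ sum-cong-≗ endpoints ⟩
      ∑[ u < M ] (χ (source e ≟ u) ℙ.* c u ℙ.+ (χ (target e ≟ u) ℙ.* c u))
        ≡⟨ ∑-distrib-+ (λ u → χ (source e ≟ u) ℙ.* c u) (λ u → χ (target e ≟ u) ℙ.* c u) ⟩
      ∑[ u < M ] (χ (source e ≟ u) ℙ.* c u) ℙ.+ ∑[ u < M ] (χ (target e ≟ u) ℙ.* c u)
        ≡⟨ cong₂ ℙ._+_ (∑-χ≟ (source e) c) (∑-χ≟ (target e) c) ⟩
      c (source e) ℙ.+ c (target e)
        ≡⟨ ≢⇒+≡1ℙ (proper e odd) ⟩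
      1ℙ
        ∎
      where
      endpoints : ∀ u → c u ℙ.* (χ (incident? u e) ℙ.* 1ℙ) ≡
                        χ (source e ≟ u) ℙ.* c u ℙ.+ (χ (target e ≟ u) ℙ.* c u)
      endpoints u = begin
        c u ℙ.* (χ (incident? u e) ℙ.* 1ℙ)             ≡⟨ cong (c u ℙ.*_) (ℙₚ.*-identityʳ _) ⟩
        c u ℙ.* χ (incident? u e)                      ≡⟨ ℙₚ.*-comm (c u) _ ⟩
        χ (incident? u e) ℙ.* c u
          ≡⟨ cong (ℙ._* c u) (χ-⊎ distinct (source e ≟ u) (target e ≟ u)) ⟩
        (χ (source e ≟ u) ℙ.+ χ (target e ≟ u)) ℙ.* c u
          ≡⟨ ℙₚ.*-distribʳ-+ (c u) (χ (source e ≟ u)) (χ (target e ≟ u)) ⟩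
        χ (source e ≟ u) ℙ.* c u ℙ.+ (χ (target e ≟ u) ℙ.* c u) ∎
        where
        distinct : ¬ (source e ≡ u × target e ≡ u)
        distinct (s≡u , t≡u) = proper e odd (cong c (trans s≡u (sym t≡u)))

inject₁-next : ∀ {k} (i : Fin (suc k)) →
  inject₁ (next i) ≡ suc i ⊎ (next i ≡ zero × suc i ≡ fromℕ (suc k))
inject₁-next {k} i with suc (toℕ i) <? suc k
... | yes i+1<k+1 = inj₁ (toℕ-injective (trans (toℕ-inject₁ _) (toℕ-fromℕ< i+1<k+1)))
... | no  i+1≮k+1 = inj₂ (refl , toℕ-injective (cong suc (trans i≡k (sym (toℕ-fromℕ k)))))
  where
  i≡k : toℕ i ≡ k
  i≡k = ℕₚ.≤-antisym (ℕₚ.≤-pred (toℕ<n i)) (ℕₚ.≤-pred (ℕₚ.≮⇒≥ i+1≮k+1))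

module Walks {v ℓ} {V : Set v} (_≟ᵥ_ : DecidableEquality V) (Adj : Rel V ℓ) where

  length : ∀ {x y} → Star Adj x y → ℕ
  length ε       = 0
  length (_ ◅ w) = suc (length w)

  length-◅◅ : ∀ {x y z} (p : Star Adj x y) (q : Star Adj y z) → length (p ◅◅ q) ≡ length p + length q
  length-◅◅ ε       q = refl
  length-◅◅ (_ ◅ p) q = cong suc (length-◅◅ p q)

  vertexAt : ∀ {x y} (w : Star Adj x y) → Fin (suc (length w)) → V
  vertexAt {x} _       zero    = x
  vertexAt     (_ ◅ w) (suc i) = vertexAt w i

  vertexAt-last : ∀ {x y} (w : Star Adj x y) → vertexAt w (fromℕ (length w)) ≡ y
  vertexAt-last ε       = refl
  vertexAt-last (_ ◅ w) = vertexAt-last w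

  stepAt : ∀ {x y} (w : Star Adj x y) (i : Fin (length w)) → Adj (vertexAt w (inject₁ i)) (vertexAt w (suc i))
  stepAt (a ◅ w) zero    = a
  stepAt (a ◅ w) (suc i) = stepAt w i

  breakAt : ∀ {x y} (w : Star Adj x y) (i : Fin (length w)) →
    Σ (Star Adj x (vertexAt w (inject₁ i))) λ p → Σ (Star Adj (vertexAt w (inject₁ i)) y) λ q →
      length w ≡ length p + length q × 1 ≤ length q
  breakAt (a ◅ w) zero    = ε , a ◅ w , refl , ℕ.s≤s ℕ.z≤n
  breakAt (a ◅ w) (suc i) with breakAt w i
  ... | p , q , eq , q≢ε = a ◅ p , q , cong suc eq , q≢ε

  Simple : ∀ {x y} → Star Adj x y → Set v
  Simple w = Injective _≡_ _≡_ (vertexAt w ∘ inject₁)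

  Repeat : ∀ {x y} → Star Adj x y → Set (v ⊔ ℓ)
  Repeat {x} {y} w = ∃ λ z → Σ (Star Adj x z) λ p → Σ (Star Adj z z) λ c → Σ (Star Adj z y) λ q →
    length w ≡ length p + (length c + length q) × 1 ≤ length c × 1 ≤ length q

  simple-or-repeat : ∀ {x y} (w : Star Adj x y) → Simple w ⊎ Repeat w
  simple-or-repeat ε = inj₁ λ { {()} }
  simple-or-repeat {x} (a ◅ w) with simple-or-repeat w
  ... | inj₂ (z , p , c , q , eq , c≢ε , q≢ε) = inj₂ (z , a ◅ p , c , q , cong suc eq , c≢ε , q≢ε)
  ... | inj₁ simple with any? (λ i → x ≟ᵥ vertexAt w (inject₁ i))
  ...   | yes (i , refl) with breakAt w i
  ...     | p , q , eq , q≢ε = inj₂ (x , ε , a ◅ p , q , cong suc eq , ℕ.s≤s ℕ.z≤n , q≢ε)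
  simple-or-repeat {x} (a ◅ w) | inj₁ simple | no fresh = inj₁ simple′
    where
    simple′ : Simple (a ◅ w)
    simple′ {zero}  {zero}  _  = refl
    simple′ {zero}  {suc j} eq = contradiction (j , eq) fresh
    simple′ {suc i} {zero}  eq = contradiction (i , sym eq) fresh
    simple′ {suc i} {suc j} eq = cong suc (simple eq)

module OddCycles (H : Graph) {ℓ} (Adj : Rel (Fin (nV H)) ℓ)
  (label : ∀ {x y} → Adj x y → Fin (nE H)) (label-joins : ∀ {x y} (a : Adj x y) → Joins H (label a) x y) where

  open Walks _≟_ Adj

  LabelledCycle : ℕ → Set ℓ
  LabelledCycle k = Σ (Cycle H k) λ C → ∀ i → Σ (Adj (vert C i) (vert C (next i))) λ a → label a ≡ edge C i

  simple⇒cycle : ∀ {x y} (a : Adj x y) (q : Star Adj y x) → Simple (a ◅ q) → LabelledCycle (length q)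
  simple⇒cycle a q simple = C , λ i → adjAt i , refl
    where
    w = a ◅ q
    vertex : Fin (suc (length q)) → Fin (nV H)
    vertex = vertexAt w ∘ inject₁
    successor : ∀ i → vertexAt w (suc i) ≡ vertex (next i)
    successor i with inject₁-next i
    ... | inj₁ next≡suc = cong (vertexAt w) (sym next≡suc)
    ... | inj₂ (next≡0 , suc≡last) rewrite next≡0 = trans (cong (vertexAt w) suc≡last) (vertexAt-last w)
    adjAt : ∀ i → Adj (vertex i) (vertex (next i))
    adjAt i = subst (Adj (vertex i)) (successor i) (stepAt w i)
    C : Cycle H (length q)
    C = record { vert = vertex ; vert-inj = simple ; edge = label ∘ adjAt ; edge-joins = label-joins ∘ adjAt }

  oddCycle-within : ∀ n {x} (w : Star Adj x x) → length w < n → parity (length w) ≡ 1ℙ →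
    ∃ λ k → parity (suc k) ≡ 1ℙ × LabelledCycle k
  oddCycle-within n ε _ ()
  oddCycle-within n (a ◅ q) _ odd with simple-or-repeat (a ◅ q)
  ... | inj₁ simple = length q , odd , simple⇒cycle a q simple
  oddCycle-within (suc n) w (ℕ.s≤s w≤n) odd | inj₂ (z , p , c , q , eq , c≢ε , q≢ε)
    with parity (length c) in parity-c
  ... | 1ℙ = oddCycle-within n c (ℕₚ.<-≤-trans c<w w≤n) parity-c
    where
    c<w : length c < length w
    c<w = subst (length c <_) (sym eq) (ℕₚ.≤-trans (ℕₚ.m<m+n (length c) q≢ε) (ℕₚ.m≤n+m _ (length p)))
  ... | 0ℙ = oddCycle-within n (p ◅◅ q) (ℕₚ.<-≤-trans p◅◅q<w w≤n) odd′
    where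
    open ≡-Reasoning
    p◅◅q<w : length (p ◅◅ q) < length w
    p◅◅q<w = subst₂ _<_ (sym (length-◅◅ p q)) (sym eq)
      (ℕₚ.+-monoʳ-< (length p) (ℕₚ.m<n+m (length q) c≢ε))
    odd′ : parity (length (p ◅◅ q)) ≡ 1ℙ
    odd′ = begin
      parity (length (p ◅◅ q))
        ≡⟨ cong parity (length-◅◅ p q) ⟩
      parity (length p + length q)
        ≡⟨ ℙₚ.+-homo-+ (length p) (length q) ⟩
      parity (length p) ℙ.+ parity (length q)
        ≡⟨ cong (λ pc → parity (length p) ℙ.+ (pc ℙ.+ parity (length q))) parity-c ⟨
      parity (length p) ℙ.+ (parity (length c) ℙ.+ parity (length q))
        ≡⟨ cong (parity (length p) ℙ.+_) (ℙₚ.+-homo-+ (length c) (length q)) ⟨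
      parity (length p) ℙ.+ parity (length c + length q)
        ≡⟨ ℙₚ.+-homo-+ (length p) _ ⟨
      parity (length p + (length c + length q))
        ≡⟨ cong parity eq ⟨
      parity (length w)
        ≡⟨ odd ⟩
      1ℙ
        ∎

-- Odd closed walks versus proper 2-colourings

module Bipartition {M ℓ} {Adj : Rel (Fin M) ℓ} (Adj? : Decidable₂ Adj) (Adj-sym : Symmetric Adj) where

  open Walks _≟_ Adj using (length)

  -- The bipartite double cover: a walk from (x , p) to (y , q) has length of parity p + q.
  Cover : Rel (Fin M × Parity) ℓ
  Cover (x , p) (y , q) = Adj x y × q ≡ p ℙ.+ 1ℙ

  cover-sym : Symmetric Cover
  cover-sym {_ , p} (a , refl) = Adj-sym a , flip-flip p
    where
    flip-flip : ∀ p → p ≡ p ℙ.+ 1ℙ ℙ.+ 1ℙ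
    flip-flip 0ℙ = refl
    flip-flip 1ℙ = refl

  project : ∀ {x y p q} → Star Cover (x , p) (y , q) → Σ (Star Adj x y) λ w → p ℙ.+ parity (length w) ≡ q
  project {p = p} ε = ε , ℙₚ.+-identityʳ p
  project {p = p} ((a , refl) ◅ s) with project s
  ... | w , eq = a ◅ w , (begin
    p ℙ.+ parity (suc (length w))     ≡⟨ cong (p ℙ.+_) (ℙₚ.+-homo-+ 1 (length w)) ⟩
    p ℙ.+ (1ℙ ℙ.+ parity (length w))  ≡⟨ ℙₚ.+-assoc p 1ℙ (parity (length w)) ⟨
    p ℙ.+ 1ℙ ℙ.+ parity (length w)    ≡⟨ eq ⟩
    _                                 ∎)
    where open ≡-Reasoning

  lift : ∀ {x y} → Star Adj x y → ∀ p → ∃ λ q → Star Cover (x , p) (y , q)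
  lift ε       p = p , ε
  lift (a ◅ w) p with lift w (p ℙ.+ 1ℙ)
  ... | q , s = q , (a , refl) ◅ s

  cover? : Decidable₂ (Star Cover)
  cover? = star-retract? index vertex vertex∘index (λ (x , p) (y , q) → Adj? x y ×-dec q ℙₚ.≟ p ℙ.+ 1ℙ)
    where
    index : Fin M × Parity → Fin (M + M)
    index (x , 0ℙ) = join M M (inj₁ x)
    index (x , 1ℙ) = join M M (inj₂ x)
    vertex : Fin (M + M) → Fin M × Parity
    vertex i = [ (_, 0ℙ) , (_, 1ℙ) ]′ (splitAt M i)
    vertex∘index : ∀ v → vertex (index v) ≡ v
    vertex∘index (x , 0ℙ) = cong [ (_, 0ℙ) , (_, 1ℙ) ]′ (splitAt-join M M (inj₁ x))
    vertex∘index (x , 1ℙ) = cong [ (_, 0ℙ) , (_, 1ℙ) ]′ (splitAt-join M M (inj₂ x))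

  OddClosedWalk : Fin M → Set ℓ
  OddClosedWalk v = Σ (Star Adj v v) λ w → parity (length w) ≡ 1ℙ

  module _ (no-odd : ∀ v → ¬ Star Cover (v , 0ℙ) (v , 1ℙ)) where

    private
      connected-isEquivalence : IsEquivalence (Star Adj)
      connected-isEquivalence = record { refl = ε ; sym = Star.reverse Adj-sym ; trans = _◅◅_ }

      open Classes connected-isEquivalence (Reachability.star? Adj?) using (rep; rep-≈; rep-cong)

      proper : ∀ {r x y} → Adj x y → Star Adj r x →
        (odd-x? : Dec (Star Cover (r , 0ℙ) (x , 1ℙ))) (odd-y? : Dec (Star Cover (r , 0ℙ) (y , 1ℙ))) →
        χ odd-x? ≢ χ odd-y?
      proper {y = y} a _ (yes odd-x) (yes odd-y) _ =
        no-odd y (Star.reverse cover-sym (odd-x ◅◅ return (a , refl)) ◅◅ odd-y)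
      proper a r⇝x (no ¬odd-x) (no ¬odd-y) _ with lift r⇝x 0ℙ
      ... | 0ℙ , even-x = ¬odd-y (even-x ◅◅ return (a , refl))
      ... | 1ℙ , odd-x  = ¬odd-x odd-x
      proper _ _ (yes _) (no _)  ()
      proper _ _ (no _)  (yes _) ()

    colour : Fin M → Parity
    colour v = χ (cover? (rep v , 0ℙ) (v , 1ℙ))

    colour-proper : ∀ {x y} → Adj x y → colour x ≢ colour y
    colour-proper {x} {y} a =
      subst (λ r → colour x ≢ χ (cover? (r , 0ℙ) (y , 1ℙ))) (rep-cong (return a))
        (proper a (rep-≈ x) (cover? (rep x , 0ℙ) (x , 1ℙ)) (cover? (rep x , 0ℙ) (y , 1ℙ)))

  oddClosedWalk-or-colouring :
    ∃ OddClosedWalk ⊎ Σ (Fin M → Parity) (λ c → ∀ {x y} → Adj x y → c x ≢ c y)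
  oddClosedWalk-or-colouring with any? (λ v → cover? (v , 0ℙ) (v , 1ℙ))
  ... | yes (v , odd) = inj₁ (v , project odd)
  ... | no ¬odd       = inj₂ (colour no-odd , colour-proper no-odd)
    where no-odd = λ v odd → ¬odd (v , odd)

module _ (H : Graph) where

  joins? : ∀ h x y → Dec (Joins H h x y)
  joins? h x y = ≡-dec _≟_ _≟_ (ends H h) (x , y) ⊎-dec ≡-dec _≟_ _≟_ (ends H h) (y , x)

  private
    Square : (Fin 4 → Fin (nV H)) → Fin (nE H) → Fin (nE H) → (Fin 4 → Fin (nE H)) → Set
    Square v e e′ c =
      Joins H (c 0F) (v 0F) (v 1F) × Joins H (c 1F) (v 1F) (v 2F) ×
      Joins H (c 2F) (v 2F) (v 3F) × Joins H (c 3F) (v 3F) (v 0F) ×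
      (∃[ i ] c i ≡ e) × (∃[ j ] c j ≡ e′)

    joins-resp : ∀ {h h′ x x′ y y′} → h ≡ h′ → x ≡ x′ → y ≡ y′ →
                 Joins H h x y → Joins H h′ x′ y′
    joins-resp refl refl refl j = j

    square-resp : ∀ {v v′ e e′ c c′} → v ≗ v′ → c ≗ c′ → Square v e e′ c → Square v′ e e′ c′
    square-resp v≗ c≗ (j₀ , j₁ , j₂ , j₃ , (i , ci≡e) , (j , cj≡e′)) =
      joins-resp (c≗ 0F) (v≗ 0F) (v≗ 1F) j₀ , joins-resp (c≗ 1F) (v≗ 1F) (v≗ 2F) j₁ ,
      joins-resp (c≗ 2F) (v≗ 2F) (v≗ 3F) j₂ , joins-resp (c≗ 3F) (v≗ 3F) (v≗ 0F) j₃ ,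
      (i , trans (sym (c≗ i)) ci≡e) , (j , trans (sym (c≗ j)) cj≡e′)

    square? : ∀ v e e′ c → Dec (Square v e e′ c)
    square? v e e′ c =
      joins? _ _ _ ×-dec joins? _ _ _ ×-dec joins? _ _ _ ×-dec joins? _ _ _ ×-dec
      any? (λ i → c i ≟ e) ×-dec any? (λ j → c j ≟ e′)

  onCommon4Cycle? : Decidable₂ (OnCommon4Cycle H)
  onCommon4Cycle? e e′ = ∃-function? 4
    (λ v≗ (inj , c , sq) → (λ eq → inj (trans (v≗ _) (trans eq (sym (v≗ _))))) ,
                           c , square-resp v≗ (λ _ → refl) sq)
    (λ v → injective? v ×-dec ∃-function? 4 (square-resp {v} (λ _ → refl)) (square? v e e′))

  ∼? : Decidable₂ (_∼_ H)
  ∼? = Reachability.star? (symClosure? onCommon4Cycle?)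

module _ {G H : Graph} (φ : Hom G H) where

  private
    Step : Fin (nE G) → Rel (Fin (nE G)) _
    Step e a b = InPre φ e a × InPre φ e b × ShareVertex G a b

    step-sym : ∀ {e a b} → Step e a b → Step e b a
    step-sym (e∼a , e∼b , v , v∈a , v∈b) = e∼b , e∼a , v , v∈b , v∈a

    step-rebase : ∀ {e e′} → InPre φ e e′ → ∀ {a b} → Step e a b → Step e′ a b
    step-rebase {e} {e′} e∼e′ (e∼a , e∼b , share) = rebase e∼a , rebase e∼b , share
      where
      rebase : ∀ {a} → InPre φ e a → InPre φ e′ a
      rebase = EqClosure.transitive _ (EqClosure.symmetric _ e∼e′)

    classPhi⇒inPre : ∀ {e a} → ClassPhi φ e a → InPre φ e a
    classPhi⇒inPre = go ε
      where
      go : ∀ {e a b} → InPre φ e a → Star (Step e) a b → InPre φ e b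
      go e∼a ε                       = e∼a
      go _   ((_ , e∼b , _) ◅ steps) = go e∼b steps

  classPhi-euclidean : ∀ {e a b} → ClassPhi φ e a → ClassPhi φ e b → ClassPhi φ a b
  classPhi-euclidean e~a e~b =
    Star.map (step-rebase (classPhi⇒inPre e~a)) (Star.reverse step-sym e~a ◅◅ e~b)

  classPhi-isEquivalence : IsEquivalence (ClassPhi φ)
  classPhi-isEquivalence = record
    { refl  = ε
    ; sym   = λ a~b → classPhi-euclidean a~b ε
    ; trans = λ a~b b~c → classPhi-euclidean (classPhi-euclidean a~b ε) b~c
    }

  classPhi? : Decidable₂ (ClassPhi φ)
  classPhi? e = Reachability.star?
    (λ a b → ∼? H (emap φ e) (emap φ a) ×-dec ∼? H (emap φ e) (emap φ b) ×-dec shareVertex? a b) e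
    where
    inc? : ∀ v a → Dec (Inc G v a)
    inc? v a = v ≟ proj₁ (ends G a) ⊎-dec v ≟ proj₂ (ends G a)
    shareVertex? : Decidable₂ (ShareVertex G)
    shareVertex? a b = any? λ v → inc? v a ×-dec inc? v b

-- Good edges and their support in H

χ*≡1ℙ : ∀ {p} {P : Set p} (P? : Dec P) {q} → χ P? ℙ.* q ≡ 1ℙ → P × q ≡ 1ℙ
χ*≡1ℙ (yes p) q≡1 = p , q≡1
χ*≡1ℙ (no _)  ()

odd⇒≢0 : ∀ {n} → parity n ≡ 1ℙ → n ≢ 0
odd⇒≢0 {zero}  () _
odd⇒≢0 {suc n} _  ()

module Witness {G H : Graph} (φ : Hom G H) (F : Multiset G) where

  open Incidence (λ e → vmap φ (proj₁ (ends G e))) (λ e → vmap φ (proj₂ (ends G e)))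
  open Classes (classPhi-isEquivalence φ) (classPhi? φ) using (∑-restrict-to-classes)

  weight : Fin (nE G) → Parity
  weight = parity ∘ F

  total-parity : IntInv G (AllEdges G) F 1 → ∑[ e < nE G ] weight e ≡ 1ℙ
  total-parity = IntInv⇒sumOn G (λ _ → yes tt) F

  local-parity : (∀ u → IntInvAt φ (AllEdges G) u F 0) → ∀ u → degree weight u ≡ 0ℙ
  local-parity even u = IntInv⇒sumOn G (λ e → yes tt ×-dec incident? u e) F (even u)

  classSum : Fin (nE G) → (Fin (nE G) → Parity) → Parity
  classSum a f = ∑[ e < nE G ] (χ (classPhi? φ a e) ℙ.* f e)

  Good : Fin (nE G) → Set
  Good a = classSum a weight ≡ 1ℙ ⊎ ∃ λ u → classSum a (λ e → χ (incident? u e) ℙ.* weight e) ≡ 1ℙ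

  good? : Decidable Good
  good? a = classSum a weight ℙₚ.≟ 1ℙ ⊎-dec
            any? λ u → classSum a (λ e → χ (incident? u e) ℙ.* weight e) ℙₚ.≟ 1ℙ

  classSum-cong : ∀ {a b} → ClassPhi φ a b → ∀ f → classSum a f ≡ classSum b f
  classSum-cong {a} {b} a~b f =
    sum-cong-≗ λ e → cong (ℙ._* f e) (χ-cong same-class (classPhi? φ a e) (classPhi? φ b e))
    where
    same-class : ∀ {e} → ClassPhi φ a e ⇔ ClassPhi φ b e
    same-class = mk⇔ (classPhi-euclidean φ a~b) (IsEquivalence.trans (classPhi-isEquivalence φ) a~b)

  good-resp : ∀ {a b} → ClassPhi φ a b → Good a → Good b
  good-resp a~b (inj₁ odd)       = inj₁ (trans (sym (classSum-cong a~b weight)) odd)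
  good-resp a~b (inj₂ (u , odd)) = inj₂ (u , trans (sym (classSum-cong a~b _)) odd)

  OddInvariant : Fin (nE G) → Set
  OddInvariant a = IntInv G (ClassPhi φ a) F 1 ⊎ ∃[ u ] IntInvAt φ (ClassPhi φ a) u F 1

  good⇒oddInvariant : ∀ {a} → Good a → OddInvariant a
  good⇒oddInvariant {a} (inj₁ odd)       = inj₁ (sumOn⇒IntInv G (classPhi? φ a) F odd)
  good⇒oddInvariant {a} (inj₂ (u , odd)) =
    inj₂ (u , sumOn⇒IntInv G (λ e → classPhi? φ a e ×-dec incident? u e) F (trans (sum-cong-≗ reassoc) odd))
    where
    reassoc : ∀ e → χ (classPhi? φ a e ×-dec incident? u e) ℙ.* weight e ≡
                    χ (classPhi? φ a e) ℙ.* (χ (incident? u e) ℙ.* weight e)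
    reassoc e = trans (cong (ℙ._* weight e) (χ-× (classPhi? φ a e) (incident? u e)))
                      (ℙₚ.*-assoc (χ (classPhi? φ a e)) (χ (incident? u e)) (weight e))

  goodWeight : Fin (nE G) → Parity
  goodWeight e = χ (good? e) ℙ.* weight e

  ∑-goodWeight : ∑[ e < nE G ] goodWeight e ≡ ∑[ e < nE G ] weight e
  ∑-goodWeight = ∑-restrict-to-classes good? good-resp weight (λ _ ¬odd → ≢1ℙ⇒≡0ℙ (¬odd ∘ inj₁))

  degree-goodWeight : ∀ u → degree goodWeight u ≡ degree weight u
  degree-goodWeight u = trans
    (sum-cong-≗ λ e → x∙yz≈y∙xz (χ (incident? u e)) (χ (good? e)) (weight e))
    (∑-restrict-to-classes good? good-resp (λ e → χ (incident? u e) ℙ.* weight e)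
      (λ _ ¬odd → ≢1ℙ⇒≡0ℙ (λ odd → ¬odd (inj₂ (u , odd)))))

  Support : Rel (Fin (nV H)) _
  Support x y = ∃ λ e → goodWeight e ≡ 1ℙ × Joins H (emap φ e) x y

  support? : Decidable₂ Support
  support? x y = any? λ e → goodWeight e ℙₚ.≟ 1ℙ ×-dec joins? H (emap φ e) x y

  support-sym : Symmetric Support
  support-sym (e , odd , inj₁ j) = e , odd , inj₂ j
  support-sym (e , odd , inj₂ j) = e , odd , inj₁ j

  no-proper-colouring : ∑[ e < nE G ] weight e ≡ 1ℙ → (∀ u → degree weight u ≡ 0ℙ) →
    (c : Fin (nV H) → Parity) → ¬ (∀ {x y} → Support x y → c x ≢ c y)
  no-proper-colouring total local c proper = contradiction (begin
    1ℙ
      ≡⟨ total ⟨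
    ∑[ e < nE G ] weight e
      ≡⟨ ∑-goodWeight ⟨
    ∑[ e < nE G ] goodWeight e
      ≡⟨ ∑-colour*degree goodWeight c (λ e odd → proper (e , odd , emap-joins φ e)) ⟨
    ∑[ u < nV H ] (c u ℙ.* degree goodWeight u)
      ≡⟨ sum-cong-≗ (λ u → cong (c u ℙ.*_) (trans (degree-goodWeight u) (local u))) ⟩
    ∑[ u < nV H ] (c u ℙ.* 0ℙ)
      ≡⟨ sum-cong-≗ (λ u → ℙₚ.*-zeroʳ (c u)) ⟩
    ∑[ u < nV H ] 0ℙ
      ≡⟨ sum-replicate-zero (nV H) ⟩
    0ℙ
      ∎) λ ()
    where open ≡-Reasoning

  open Bipartition support? support-sym public using (OddClosedWalk; oddClosedWalk-or-colouring)
  open OddCycles H Support (emap φ ∘ proj₁) (proj₂ ∘ proj₂) using (LabelledCycle; oddCycle-within)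

  support-edge : ∀ {x y} (a : Support x y) → F (proj₁ a) ≢ 0 × Good (proj₁ a)
  support-edge (e , odd-e , _) = odd⇒≢0 (proj₂ good×oddF) , proj₁ good×oddF
    where good×oddF = χ*≡1ℙ (good? e) odd-e

  oddCycle⇒witness : ∀ {k} → parity (suc k) ≡ 1ℙ → LabelledCycle k →
    ∃[ e ] (F e ≢ 0) × OnOddCycleIn φ F e × OddInvariant e
  oddCycle⇒witness {k} odd-k (C , labelled) =
    e , proj₁ (support-edge a) , (k , odd⇒%2≡1 (suc k) odd-k , C , (zero , sym (proj₂ (labelled zero))) , inImage) ,
    good⇒oddInvariant (proj₂ (support-edge a))
    where
    a = proj₁ (labelled zero)
    e = proj₁ a
    inImage : ∀ i → InImage φ F (edge C i)
    inImage i = proj₁ (proj₁ (labelled i)) , proj₁ (support-edge (proj₁ (labelled i))) , proj₂ (labelled i)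

  oddClosedWalk⇒witness : ∀ {v} → OddClosedWalk v →
    ∃[ e ] (F e ≢ 0) × OnOddCycleIn φ F e × OddInvariant e
  oddClosedWalk⇒witness (w , odd) =
    let k , odd-k , cycle = oddCycle-within _ w (ℕₚ.n<1+n _) odd in oddCycle⇒witness odd-k cycle

lemma3p2 : (G H : Graph) (φ : Hom G H) (F : Multiset G) →
    IntInv G (AllEdges G) F 1 →
    (∀ u → IntInvAt φ (AllEdges G) u F 0) →
    ∃[ e ] (F e ≢ 0) × OnOddCycleIn φ F e ×
      (IntInv G (ClassPhi φ e) F 1 ⊎ (∃[ u ] IntInvAt φ (ClassPhi φ e) u F 1))
lemma3p2 G H φ F total-odd locally-even =
  [ (λ (_ , oddWalk) → oddClosedWalk⇒witness oddWalk)
  , (λ (c , proper) → ⊥-elim (no-proper-colouring (total-parity total-odd) (local-parity locally-even) c proper))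
  ]′ oddClosedWalk-or-colouring
  where open Witness φ F
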